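{- For $n\ge0$, let $q_n$ be the number of permutations of $\{1,\dots,n\}$ that avoid each of the patterns $2341$, $2413$, $2431$ and $3241$. Define a sequence $(s_n)_{n\ge0}$ by $s_0=s_1=1$ and, for $n>1$, $$s_n=\sum_{i=1}^{n-1}\sum_{j=i+1}^{n} 2\, s_{i-1}\,s_{j-i-1}\,s_{n-j}.$$ Then $q_n\ge s_n$ for all $n\ge0$.
   Context: A permutation $\pi$ of length $n$ contains a pattern $\sigma$ of length $k$ if some subsequence of $\pi$ (of length $k$) is order-isomorphic to $\sigma$; otherwise $\pi$ avoids $\sigma$. The empty permutation is the unique permutation of length $0$. -}

module Defs where

open import Data.Nat using (ℕ; zero; suc; _+_; _*_; _∸_; _<ᵇ_)
open import Data.Bool using (Bool; true; false; _∧_; _∨_; not; if_then_else_)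
open import Data.Bool.Properties using () renaming (_≟_ to _≟ᵇ_)
open import Data.Fin using (Fin; toℕ; #_)
open import Data.Fin.Properties using (_≟_)
open import Data.Vec using (Vec; []; _∷_; lookup)
open import Data.List using (List; []; _∷_; [_]; map; concatMap; allFin; upTo; length; filter; _++_)

allB : ∀ {A : Set} → (A → Bool) → List A → Bool
allB p []       = true
allB p (x ∷ xs) = p x ∧ allB p xs

anyB : ∀ {A : Set} → (A → Bool) → List A → Bool
anyB p []       = false
anyB p (x ∷ xs) = p x ∨ anyB p xs

sumL : List ℕ → ℕ
sumL []       = 0
sumL (x ∷ xs) = x + sumL xs
open import Relation.Nullary.Decidable using (⌊_⌋; does)
open import Relation.Binary.PropositionalEquality using (_≡_)

-- A permutation of {1..n} (0-based: of Fin n) in one-line notation is an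
-- injective word  π : Vec (Fin n) n  (π(a) = lookup π a).

words : (k n : ℕ) → List (Vec (Fin n) k)
words zero    n = [ [] ]
words (suc k) n = concatMap (λ x → map (x ∷_) (words k n)) (allFin n)

_<F_ : ∀ {n} → Fin n → Fin n → Bool
a <F b = toℕ a <ᵇ toℕ b

isInjective : ∀ {k n} → Vec (Fin n) k → Bool
isInjective {k} w =
  allB (λ a → allB (λ b → not (does (lookup w a ≟ lookup w b)) ∨ does (a ≟ b))
                 (allFin k)) (allFin k)

perms : (n : ℕ) → List (Vec (Fin n) n)
perms n = filter (λ w → isInjective w ≟ᵇ true) (words n n)

increasing : ∀ {k n} → Vec (Fin n) k → Bool
increasing {k} idx =
  allB (λ a → allB (λ b → not (a <F b) ∨ (lookup idx a <F lookup idx b))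
                 (allFin k)) (allFin k)

orderIso : ∀ {k n} → Vec (Fin n) n → Vec (Fin k) k → Vec (Fin n) k → Bool
orderIso {k} π σ idx =
  allB (λ a → allB (λ b → does ((lookup π (lookup idx a) <F lookup π (lookup idx b))
                               ≟ᵇ (lookup σ a <F lookup σ b)))
                 (allFin k)) (allFin k)

contains : ∀ {k n} → Vec (Fin n) n → Vec (Fin k) k → Bool
contains {k} {n} π σ = anyB (λ idx → increasing idx ∧ orderIso π σ idx) (words k n)

avoids : ∀ {k n} → Vec (Fin n) n → Vec (Fin k) k → Bool
avoids π σ = not (contains π σ)

-- patterns, written 0-based (2341 ↦ 1 2 3 0, etc.)
p2341 p2413 p2431 p3241 : Vec (Fin 4) 4
p2341 = # 1 ∷ # 2 ∷ # 3 ∷ # 0 ∷ []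
p2413 = # 1 ∷ # 3 ∷ # 0 ∷ # 2 ∷ []
p2431 = # 1 ∷ # 3 ∷ # 2 ∷ # 0 ∷ []
p3241 = # 2 ∷ # 1 ∷ # 3 ∷ # 0 ∷ []

avoidsAll : ∀ {n} → Vec (Fin n) n → Bool
avoidsAll π = avoids π p2341 ∧ avoids π p2413 ∧ avoids π p2431 ∧ avoids π p3241

q : ℕ → ℕ
q n = length (filter (λ π → avoidsAll π ≟ᵇ true) (perms n))

-- Σ_{i = lo}^{hi} f i  (empty if hi < lo)
Σ[_⋯_] : ℕ → ℕ → (ℕ → ℕ) → ℕ
Σ[ lo ⋯ hi ] f = sumL (map (λ d → f (lo + d)) (upTo (suc hi ∸ lo)))

-- index into a list, default 0
at : List ℕ → ℕ → ℕ
at []       _       = 0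
at (x ∷ xs) zero    = x
at (x ∷ xs) (suc i) = at xs i

-- given t = [s_0, …, s_{n-1}], the value s_n for n > 1
sStep : ℕ → List ℕ → ℕ
sStep n t = Σ[ 1 ⋯ n ∸ 1 ] (λ i → Σ[ suc i ⋯ n ] (λ j →
              2 * at t (i ∸ 1) * at t (j ∸ i ∸ 1) * at t (n ∸ j)))

sTable : ℕ → List ℕ
sTable zero          = 1 ∷ []
sTable (suc zero)    = 1 ∷ 1 ∷ []
sTable (suc (suc m)) = sTable (suc m) ++ [ sStep (suc (suc m)) (sTable (suc m)) ]

s : ℕ → ℕ
s n = at (sTable n) n

module Submission where

-- Idea: for A + 1 + B + 1 + C = n and avoiders α, β, γ of sizes A, B, C, the
-- two inflations  α n β (n-1) γ  and  α (n-1) β n γ  (α below β below γ below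
-- the two points) are again avoiders, and distinct data (A, B, skeleton,
-- α, β, γ) give distinct permutations.  With i = A + 1 and j = A + B + 2 there
-- are 2 q_{i-1} q_{j-i-1} q_{n-j} of them for each i < j, so by strong
-- induction q n ≥ s n.
--
-- Recovering the blocks and the shape from an inflation makes the
-- family of all inflations duplicate-free; comparing its length with the
-- recursion for s finishes the proof.

open import Defs

open import Data.Nat using (ℕ; zero; suc; _+_; _*_; _∸_; _<_; _≤_; _≥_; _<ᵇ_; z≤n; s≤s; s≤s⁻¹; _<?_)
open import Data.Nat.Properties
open import Data.Nat.Induction using (<-rec)
open import Data.Nat.Tactic.RingSolver using (solve-∀)
open import Data.Bool using (Bool; true; false; _∧_; _∨_; not; T; if_then_else_)
open import Data.Bool.Properties using () renaming (_≟_ to _≟ᵇ_)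
open import Data.Fin using (Fin; toℕ; fromℕ<; #_) renaming (zero to fz; suc to fs)
open import Data.Fin.Properties using (toℕ-fromℕ<; toℕ-injective; toℕ<n) renaming (_≟_ to _≟F_)
open import Data.Vec using (Vec; []; _∷_; lookup; tabulate)
open import Data.Vec.Properties using (lookup∘tabulate)
open import Data.List using (List; []; _∷_; [_]; map; concatMap; allFin; upTo; length; filter; _++_; cartesianProduct)
open import Data.List.Properties using (length-++; length-map)
open import Data.List.Membership.Propositional using (_∈_)
open import Data.List.Membership.Propositional.Properties
open import Data.List.Relation.Unary.Any using (here; there)
import Data.List.Relation.Unary.All as All
open import Data.List.Relation.Unary.AllPairs using ([]; _∷_)
open import Data.List.Relation.Unary.Unique.Propositional using (Unique)
import Data.List.Relation.Unary.Unique.Propositional.Properties as Unique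
open import Data.Product using (∃; _×_; _,_; proj₁; proj₂)
open import Data.Sum using (inj₁; inj₂; [_,_]′)
open import Data.Empty using (⊥; ⊥-elim)
open import Function using (flip)
open import Relation.Nullary using (Dec; ¬_; yes; no)
open import Relation.Nullary.Decidable using (does)
open import Relation.Binary.PropositionalEquality hiding ([_])
open import Relation.Binary.Definitions using (tri<; tri≈; tri>)

false≢true : false ≢ true
false≢true ()

∧-true : ∀ {a b} → a ∧ b ≡ true → a ≡ true × b ≡ true
∧-true {true}  {true}  refl = refl , refl
∧-true {true}  {false} ()
∧-true {false} ()

does-sound : ∀ {P : Set} (d : Dec P) → does d ≡ true → P
does-sound (yes p) _ = p

does-complete : ∀ {P : Set} (d : Dec P) → P → does d ≡ true
does-complete (yes _) _  = refl
does-complete (no ¬p) p = ⊥-elim (¬p p)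

does-refute : ∀ {P : Set} (d : Dec P) → not (does d) ≡ true → ¬ P
does-refute (no ¬p) _ = ¬p

<ᵇ-sound : ∀ {m n} → (m <ᵇ n) ≡ true → m < n
<ᵇ-sound {m} {n} h = <ᵇ⇒< m n (subst T (sym h) _)

<ᵇ-complete : ∀ {m n} → m < n → (m <ᵇ n) ≡ true
<ᵇ-complete {m} {n} m<n with m <ᵇ n | <⇒<ᵇ m<n
... | true | _ = refl

<ᵇ-false-sound : ∀ {m n} → (m <ᵇ n) ≡ false → n ≤ m
<ᵇ-false-sound h = ≮⇒≥ (λ m<n → false≢true (trans (sym h) (<ᵇ-complete m<n)))

<ᵇ-false-complete : ∀ {m n} → n ≤ m → (m <ᵇ n) ≡ false
<ᵇ-false-complete {m} {n} n≤m with m <ᵇ n in eq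
... | false = refl
... | true  = ⊥-elim (<⇒≱ (<ᵇ-sound eq) n≤m)

allB-sound : ∀ {A : Set} {p : A → Bool} {xs} → allB p xs ≡ true → ∀ {x} → x ∈ xs → p x ≡ true
allB-sound {xs = _ ∷ _} h (here refl) = proj₁ (∧-true h)
allB-sound {xs = _ ∷ _} h (there x∈)  = allB-sound (proj₂ (∧-true h)) x∈

allB-complete : ∀ {A : Set} {p : A → Bool} {xs} → (∀ {x} → x ∈ xs → p x ≡ true) → allB p xs ≡ true
allB-complete {xs = []}    _ = refl
allB-complete {xs = _ ∷ _} h rewrite h (here refl) = allB-complete (λ x∈ → h (there x∈))

anyB-sound : ∀ {A : Set} {p : A → Bool} {xs} → anyB p xs ≡ true → ∃ λ x → x ∈ xs × p x ≡ true
anyB-sound {p = p} {xs = x ∷ _} h with p x in px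
... | true  = x , here refl , px
... | false with anyB-sound h
...   | y , y∈ , py = y , there y∈ , py

anyB-complete : ∀ {A : Set} {p : A → Bool} {xs x} → x ∈ xs → p x ≡ true → anyB p xs ≡ true
anyB-complete {p = p} {xs = y ∷ _} (here refl) px rewrite px = refl
anyB-complete {p = p} {xs = y ∷ _} (there x∈) px with p y
... | true  = refl
... | false = anyB-complete x∈ px

All² : ∀ {k} → (Fin k → Fin k → Bool) → Bool
All² {k} p = allB (λ a → allB (p a) (allFin k)) (allFin k)

All²-sound : ∀ {k} {p : Fin k → Fin k → Bool} → All² p ≡ true → ∀ a b → p a b ≡ true
All²-sound {k} h a b = allB-sound {xs = allFin k} (allB-sound {xs = allFin k} h (∈-allFin a)) (∈-allFin b)

All²-complete : ∀ {k} {p : Fin k → Fin k → Bool} → (∀ a b → p a b ≡ true) → All² p ≡ true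
All²-complete {k} h = allB-complete {xs = allFin k} (λ {a} _ → allB-complete {xs = allFin k} (λ {b} _ → h a b))

Any²-sound : ∀ {k} {p : Fin k → Fin k → Bool} → anyB (λ a → anyB (p a) (allFin k)) (allFin k) ≡ true →
             ∃ λ a → ∃ λ b → p a b ≡ true
Any²-sound {k} h with anyB-sound {xs = allFin k} h
... | a , _ , ha with anyB-sound {xs = allFin k} ha
...   | b , _ , hab = a , b , hab

∈-words : ∀ {k n} (v : Vec (Fin n) k) → v ∈ words k n
∈-words []      = here refl
∈-words (x ∷ v) = ∈-concat⁺′ (∈-map⁺ (x ∷_) (∈-words v)) (∈-map⁺ _ (∈-allFin x))

isInjective-sound : ∀ {k n} {w : Vec (Fin n) k} → isInjective w ≡ true →
                    ∀ a b → lookup w a ≡ lookup w b → a ≡ b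
isInjective-sound {w = w} h a b wa≡wb = decide (All²-sound h a b)
  where
  decide : (not (does (lookup w a ≟F lookup w b)) ∨ does (a ≟F b)) ≡ true → a ≡ b
  decide _  with lookup w a ≟F lookup w b | a ≟F b
  ... | _        | yes a≡b = a≡b
  ... | no wa≢wb | no _    = ⊥-elim (wa≢wb wa≡wb)

isInjective-complete : ∀ {k n} {w : Vec (Fin n) k} →
                       (∀ a b → lookup w a ≡ lookup w b → a ≡ b) → isInjective w ≡ true
isInjective-complete {w = w} inj = All²-complete check
  where
  check : ∀ a b → (not (does (lookup w a ≟F lookup w b)) ∨ does (a ≟F b)) ≡ true
  check a b with lookup w a ≟F lookup w b | a ≟F b
  ... | yes wa≡wb | no a≢b = ⊥-elim (a≢b (inj a b wa≡wb))
  ... | yes _     | yes _  = refl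
  ... | no _      | _      = refl

increasing-sound : ∀ {k n} {idx : Vec (Fin n) k} → increasing idx ≡ true →
                   ∀ a b → toℕ a < toℕ b → toℕ (lookup idx a) < toℕ (lookup idx b)
increasing-sound h a b a<b with All²-sound h a b
... | h′ rewrite <ᵇ-complete a<b = <ᵇ-sound h′

increasing-complete : ∀ {k n} {idx : Vec (Fin n) k} →
                      (∀ a b → toℕ a < toℕ b → toℕ (lookup idx a) < toℕ (lookup idx b)) →
                      increasing idx ≡ true
increasing-complete {idx = idx} mono = All²-complete check
  where
  check : ∀ a b → (not (a <F b) ∨ (lookup idx a <F lookup idx b)) ≡ true
  check a b with toℕ a <ᵇ toℕ b in a<b
  ... | false = refl
  ... | true rewrite <ᵇ-complete (mono a b (<ᵇ-sound a<b)) = refl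

orderIso-sound : ∀ {k n} {π : Vec (Fin n) n} {σ : Vec (Fin k) k} {idx : Vec (Fin n) k} →
                 orderIso π σ idx ≡ true →
                 ∀ a b → (lookup π (lookup idx a) <F lookup π (lookup idx b)) ≡ (lookup σ a <F lookup σ b)
orderIso-sound h a b = does-sound (_ ≟ᵇ _) (All²-sound h a b)

orderIso-complete : ∀ {k n} {π : Vec (Fin n) n} {σ : Vec (Fin k) k} {idx : Vec (Fin n) k} →
                    (∀ a b → (lookup π (lookup idx a) <F lookup π (lookup idx b)) ≡ (lookup σ a <F lookup σ b)) →
                    orderIso π σ idx ≡ true
orderIso-complete iso = All²-complete (λ a b → does-complete (_ ≟ᵇ _) (iso a b))

Occurrence : ∀ {k n} → Vec (Fin n) n → Vec (Fin k) k → Set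
Occurrence {k} {n} π σ = ∃ λ (idx : Vec (Fin n) k) → increasing idx ≡ true × orderIso π σ idx ≡ true

contains-sound : ∀ {k n} {π : Vec (Fin n) n} {σ : Vec (Fin k) k} → contains π σ ≡ true → Occurrence π σ
contains-sound {k} {n} h with anyB-sound {xs = words k n} h
... | idx , _ , found = idx , ∧-true found

contains-complete : ∀ {k n} {π : Vec (Fin n) n} {σ : Vec (Fin k) k} → Occurrence π σ → contains π σ ≡ true
contains-complete {k} {n} (idx , inc , iso) = anyB-complete {xs = words k n} (∈-words idx) (cong₂ _∧_ inc iso)

unique-length : ∀ {A : Set} {xs ys : List A} → Unique xs → (∀ {x} → x ∈ xs → x ∈ ys) → length xs ≤ length ys
unique-length {xs = []}     _          _   = z≤n
unique-length {xs = x ∷ xs} (x∉ ∷ uxs) xs⊆ys with ∈-∃++ (xs⊆ys (here refl))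
... | us , ws , refl = subst (suc (length xs) ≤_) (sym length-split) (s≤s (unique-length uxs xs⊆us++ws))
  where
  x∉xs : ∀ {y} → y ∈ xs → y ≢ x
  x∉xs y∈ y≡x = All.lookup x∉ y∈ (sym y≡x)
  drop-x : ∀ vs {y} → y ∈ vs ++ x ∷ ws → y ≢ x → y ∈ vs ++ ws
  drop-x []       (here y≡x) y≢x = ⊥-elim (y≢x y≡x)
  drop-x []       (there y∈) _   = y∈
  drop-x (_ ∷ vs) (here y≡v) _   = here y≡v
  drop-x (_ ∷ vs) (there y∈) y≢x = there (drop-x vs y∈ y≢x)
  xs⊆us++ws : ∀ {y} → y ∈ xs → y ∈ us ++ ws
  xs⊆us++ws y∈ = drop-x us (xs⊆ys (there y∈)) (x∉xs y∈)
  length-split : length (us ++ x ∷ ws) ≡ suc (length (us ++ ws))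
  length-split = begin
    length (us ++ x ∷ ws)          ≡⟨ length-++ us ⟩
    length us + suc (length ws)    ≡⟨ +-suc (length us) (length ws) ⟩
    suc (length us + length ws)    ≡⟨ cong suc (sym (length-++ us)) ⟩
    suc (length (us ++ ws))        ∎
    where open ≡-Reasoning

unique-concatMap : ∀ {A B : Set} (g : A → List B) {xs} → Unique xs →
  (∀ {x} → x ∈ xs → Unique (g x)) →
  (∀ {x x′ y} → x ∈ xs → x′ ∈ xs → y ∈ g x → y ∈ g x′ → x ≡ x′) →
  Unique (concatMap g xs)
unique-concatMap g {[]}     _          _     _        = []
unique-concatMap g {x ∷ xs} (x∉ ∷ uxs) ugx disjoint =
  Unique.++⁺ (ugx (here refl))
             (unique-concatMap g uxs (λ x∈ → ugx (there x∈)) (λ x∈ x′∈ → disjoint (there x∈) (there x′∈)))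
             apart
  where
  apart : ∀ {y} → ¬ (y ∈ g x × y ∈ concatMap g xs)
  apart (y∈gx , y∈rest) with ∈-concat⁻′ (map g xs) y∈rest
  ... | _ , y∈gz , gz∈ with ∈-map⁻ g gz∈
  ...   | z , z∈ , refl = All.lookup x∉ z∈ (disjoint (here refl) (there z∈) y∈gx y∈gz)

unique-words : ∀ k n → Unique (words k n)
unique-words zero    n = All.[] ∷ []
unique-words (suc k) n =
  unique-concatMap (λ x → map (x ∷_) (words k n)) (Unique.allFin⁺ n)
    (λ _ → Unique.map⁺ ∷-injectiveʳ (unique-words k n)) same-head
  where
  ∷-injectiveʳ : ∀ {x} {v w : Vec (Fin n) k} → x ∷ v ≡ x ∷ w → v ≡ w
  ∷-injectiveʳ refl = refl
  same-head : ∀ {x x′ y} → x ∈ allFin n → x′ ∈ allFin n →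
              y ∈ map (x ∷_) (words k n) → y ∈ map (x′ ∷_) (words k n) → x ≡ x′
  same-head _ _ y∈ y∈′ with ∈-map⁻ _ y∈ | ∈-map⁻ _ y∈′
  ... | _ , _ , refl | _ , _ , refl = refl

Avoider : ∀ {n} → Vec (Fin n) n → Set
Avoider π = isInjective π ≡ true × avoidsAll π ≡ true

-- Opaque, so that the (huge) enumeration is never unfolded during type checking.
opaque
  avoiders : (n : ℕ) → List (Vec (Fin n) n)
  avoiders n = filter (λ π → avoidsAll π ≟ᵇ true) (perms n)

  q≡length-avoiders : ∀ n → q n ≡ length (avoiders n)
  q≡length-avoiders n = refl

  ∈-avoiders : ∀ {n} {π : Vec (Fin n) n} → Avoider π → π ∈ avoiders n
  ∈-avoiders {π = π} (inj , avoid) =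
    ∈-filter⁺ _ (∈-filter⁺ (λ w → isInjective w ≟ᵇ true) (∈-words π) inj) avoid

  avoiders-sound : ∀ {n} {π : Vec (Fin n) n} → π ∈ avoiders n → Avoider π
  avoiders-sound {n} π∈ with ∈-filter⁻ (λ π → avoidsAll π ≟ᵇ true) {xs = perms n} π∈
  ... | π∈perms , avoid = proj₂ (∈-filter⁻ (λ w → isInjective w ≟ᵇ true) {xs = words n n} π∈perms) , avoid

  unique-avoiders : ∀ n → Unique (avoiders n)
  unique-avoiders n = Unique.filter⁺ _ (Unique.filter⁺ _ (unique-words n n))

length≤q : ∀ {n} {πs : List (Vec (Fin n) n)} → Unique πs → (∀ {π} → π ∈ πs → Avoider π) → length πs ≤ q n
length≤q {n} {πs} uπs good = subst (length πs ≤_) (sym (q≡length-avoiders n)) (unique-length uπs (λ π∈ → ∈-avoiders (good π∈)))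

length-concatMap : ∀ {A B : Set} (g : A → List B) xs → length (concatMap g xs) ≡ sumL (map (λ x → length (g x)) xs)
length-concatMap g []       = refl
length-concatMap g (x ∷ xs) = trans (length-++ (g x)) (cong (length (g x) +_) (length-concatMap g xs))

length-cartesianProduct : ∀ {A B : Set} (xs : List A) (ys : List B) →
                          length (cartesianProduct xs ys) ≡ length xs * length ys
length-cartesianProduct []       ys = refl
length-cartesianProduct (x ∷ xs) ys =
  trans (length-++ (map (x ,_) ys)) (cong₂ _+_ (length-map (x ,_) ys) (length-cartesianProduct xs ys))

sumL-mono : ∀ {F G : ℕ → ℕ} xs → (∀ {d} → d ∈ xs → F d ≤ G d) → sumL (map F xs) ≤ sumL (map G xs)
sumL-mono []       _     = z≤n
sumL-mono (x ∷ xs) F≤G = +-mono-≤ (F≤G (here refl)) (sumL-mono xs (λ d∈ → F≤G (there d∈)))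

ForEachPattern : (Vec (Fin 4) 4 → Set) → Set
ForEachPattern P = P p2341 × P p2413 × P p2431 × P p3241

zipPatterns : ∀ {P Q R : Vec (Fin 4) 4 → Set} → (∀ σ → P σ → Q σ → R σ) →
              ForEachPattern P → ForEachPattern Q → ForEachPattern R
zipPatterns f (p₁ , p₂ , p₃ , p₄) (q₁ , q₂ , q₃ , q₄) = f _ p₁ q₁ , f _ p₂ q₂ , f _ p₃ q₃ , f _ p₄ q₄

patterns-∀ : ∀ {I : Set} {P : I → Vec (Fin 4) 4 → Set} →
             (∀ i → ForEachPattern (P i)) → ForEachPattern (λ σ → ∀ i → P i σ)
patterns-∀ h = (λ i → proj₁ (h i)) , (λ i → proj₁ (proj₂ (h i))) ,
               (λ i → proj₁ (proj₂ (proj₂ (h i)))) , (λ i → proj₂ (proj₂ (proj₂ (h i))))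

AvoidsFour : ∀ {n} → Vec (Fin n) n → Set
AvoidsFour π = ForEachPattern (λ σ → contains π σ ≡ false)

avoidsAll-sound : ∀ {n} {π : Vec (Fin n) n} → avoidsAll π ≡ true → AvoidsFour π
avoidsAll-sound {π = π} h with contains π p2341 | contains π p2413 | contains π p2431 | contains π p3241
... | false | false | false | false = refl , refl , refl , refl

avoidsAll-complete : ∀ {n} {π : Vec (Fin n) n} → AvoidsFour π → avoidsAll π ≡ true
avoidsAll-complete (a , b , c , d) rewrite a | b | c | d = refl

-- nth v p is the value (in ℕ) at position p of v, and 0 beyond its end;
-- it lets positions be computed arithmetically instead of in Fin.
nth : ∀ {m l} → Vec (Fin m) l → ℕ → ℕ
nth []      _       = 0
nth (x ∷ v) zero    = toℕ x
nth (x ∷ v) (suc p) = nth v p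

nth-lookup : ∀ {m l} (v : Vec (Fin m) l) (i : Fin l) → nth v (toℕ i) ≡ toℕ (lookup v i)
nth-lookup (x ∷ v) fz     = refl
nth-lookup (x ∷ v) (fs i) = nth-lookup v i

nth-< : ∀ {m l} (v : Vec (Fin m) l) {p} → p < l → nth v p < m
nth-< (x ∷ v) {zero}  _         = toℕ<n x
nth-< (x ∷ v) {suc p} (s≤s p<l) = nth-< v p<l

nth-injective : ∀ {m l} {v : Vec (Fin m) l} → isInjective v ≡ true →
                ∀ {p p′} → p < l → p′ < l → nth v p ≡ nth v p′ → p ≡ p′
nth-injective {v = v} inj {p} {p′} p<l p′<l vp≡vp′ = begin
  p                   ≡⟨ toℕ-fromℕ< p<l ⟨
  toℕ (fromℕ< p<l)    ≡⟨ cong toℕ (isInjective-sound {w = v} inj _ _ (toℕ-injective same-value)) ⟩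
  toℕ (fromℕ< p′<l)   ≡⟨ toℕ-fromℕ< p′<l ⟩
  p′                  ∎
  where
  open ≡-Reasoning
  value-at : ∀ {p} (p<l : p < _) → toℕ (lookup v (fromℕ< p<l)) ≡ nth v p
  value-at p<l = trans (sym (nth-lookup v (fromℕ< p<l))) (cong (nth v) (toℕ-fromℕ< p<l))
  same-value : toℕ (lookup v (fromℕ< p<l)) ≡ toℕ (lookup v (fromℕ< p′<l))
  same-value = trans (value-at p<l) (trans vp≡vp′ (sym (value-at p′<l)))

nth-ext : ∀ {m l} (v w : Vec (Fin m) l) → (∀ p → p < l → nth v p ≡ nth w p) → v ≡ w
nth-ext []      []      _    = refl
nth-ext (x ∷ v) (y ∷ w) same =
  cong₂ _∷_ (toℕ-injective (same 0 (s≤s z≤n))) (nth-ext v w (λ p p<l → same (suc p) (s≤s p<l)))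

-- prefixSum g i = g 0 + … + g (i - 1): the start of the i-th of a row of
-- consecutive intervals of lengths g 0, g 1, ….
prefixSum : (ℕ → ℕ) → ℕ → ℕ
prefixSum g zero    = 0
prefixSum g (suc i) = prefixSum g i + g i

prefixSum-mono : ∀ g {i j} → i ≤ j → prefixSum g i ≤ prefixSum g j
prefixSum-mono g {j = zero}  z≤n = ≤-refl
prefixSum-mono g {i} {suc j} i≤j with m≤n⇒m<n∨m≡n i≤j
... | inj₂ refl      = ≤-refl
... | inj₁ (s≤s i≤j) = ≤-trans (prefixSum-mono g i≤j) (m≤m+n (prefixSum g j) (g j))

prefixSum-disjoint : ∀ g {i j} → i < j → prefixSum g i + g i ≤ prefixSum g j
prefixSum-disjoint g (s≤s i≤j) = prefixSum-mono g (s≤s i≤j)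

offset-< : ∀ {p st len} → st ≤ p → p < st + len → p ∸ st < len
offset-< {p} {st} {len} st≤p p<end = subst (p ∸ st <_) (m+n∸m≡n st len) (∸-monoˡ-< p<end st≤p)

-- Block sizes in position order α, •, β, •, γ (where • is a single point) …
positionSize : ℕ → ℕ → ℕ → ℕ → ℕ
positionSize A B C 0 = A
positionSize A B C 1 = 1
positionSize A B C 2 = B
positionSize A B C 3 = 1
positionSize A B C _ = C

-- … and in value order: α below β below γ below both points •.
valueSize : ℕ → ℕ → ℕ → ℕ → ℕ
valueSize A B C 0 = A
valueSize A B C 1 = B
valueSize A B C 2 = C
valueSize A B C _ = 1

pattern blockα = fz
pattern point₁ = fs fz
pattern blockβ = fs (fs fz)
pattern point₂ = fs (fs (fs fz))
pattern blockγ = fs (fs (fs (fs fz)))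

-- The two skeletons, as the value rank of each block: o = false is 15243,
-- giving α n β (n-1) γ, and o = true is 14253, giving α (n-1) β n γ.
rank : Bool → Fin 5 → Fin 5
rank _     blockα = # 0
rank false point₁ = # 4
rank true  point₁ = # 3
rank _     blockβ = # 1
rank false point₂ = # 3
rank true  point₂ = # 4
rank _     blockγ = # 2

unrank : Bool → Fin 5 → Fin 5
unrank _     blockα = blockα
unrank _     point₁ = blockβ
unrank _     blockβ = blockγ
unrank false point₂ = point₂
unrank true  point₂ = point₁
unrank false blockγ = point₁
unrank true  blockγ = point₂

unrank-rank : ∀ o r → unrank o (rank o r) ≡ r
unrank-rank false blockα = refl
unrank-rank false point₁ = refl
unrank-rank false blockβ = refl
unrank-rank false point₂ = refl
unrank-rank false blockγ = refl
unrank-rank true  blockα = refl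
unrank-rank true  point₁ = refl
unrank-rank true  blockβ = refl
unrank-rank true  point₂ = refl
unrank-rank true  blockγ = refl

rank-injective : ∀ o {r r′} → rank o r ≡ rank o r′ → r ≡ r′
rank-injective o {r} {r′} e = trans (sym (unrank-rank o r)) (trans (cong (unrank o) e) (unrank-rank o r′))

valueSize-rank : ∀ {A B C} o r → valueSize A B C (toℕ (rank o r)) ≡ positionSize A B C (toℕ r)
valueSize-rank false blockα = refl
valueSize-rank false point₁ = refl
valueSize-rank false blockβ = refl
valueSize-rank false point₂ = refl
valueSize-rank false blockγ = refl
valueSize-rank true  blockα = refl
valueSize-rank true  point₁ = refl
valueSize-rank true  blockβ = refl
valueSize-rank true  point₂ = refl
valueSize-rank true  blockγ = refl

isPoint : Fin 5 → Bool
isPoint point₁ = true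
isPoint point₂ = true
isPoint _      = false

point-size : ∀ {A B C} r → isPoint r ≡ true → positionSize A B C (toℕ r) ≡ 1
point-size point₁ _ = refl
point-size point₂ _ = refl

-- The point blocks holding the largest value n - 1 and the value n - 2.
topPoint secondPoint : Bool → Fin 5
topPoint    false = point₁
topPoint    true  = point₂
secondPoint false = point₂
secondPoint true  = point₁

rank-topPoint : ∀ o → rank o (topPoint o) ≡ # 4
rank-topPoint false = refl
rank-topPoint true  = refl

rank-secondPoint : ∀ o → rank o (secondPoint o) ≡ # 3
rank-secondPoint false = refl
rank-secondPoint true  = refl

isPoint-topPoint : ∀ o → isPoint (topPoint o) ≡ true
isPoint-topPoint false = refl
isPoint-topPoint true  = refl

isPoint-secondPoint : ∀ o → isPoint (secondPoint o) ≡ true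
isPoint-secondPoint false = refl
isPoint-secondPoint true  = refl

-- Conditions on the blocks w a visited by the points a of an occurrence of a
-- pattern in an inflation: they are visited in position order, a one-point
-- block is visited at most once, and possibly all points lie in one block.
visitsInOrder : ∀ {k} → Vec (Fin 5) k → Bool
visitsInOrder w = All² (λ a b → not (a <F b) ∨ not (lookup w b <F lookup w a))

pointsOnce : ∀ {k} → Vec (Fin 5) k → Bool
pointsOnce w = All² (λ a b → not (a <F b) ∨ not (isPoint (lookup w a) ∧ does (lookup w a ≟F lookup w b)))

oneBlock : ∀ {k} → Vec (Fin 5) k → Bool
oneBlock w = All² (λ a b → does (lookup w a ≟F lookup w b))

skeletonRefutes : ∀ {k} → Bool → Vec (Fin k) k → Vec (Fin 5) k → Bool
skeletonRefutes {k} o σ w =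
  anyB (λ a → anyB (λ b → not (does (lookup w a ≟F lookup w b)) ∧
                          not (does ((rank o (lookup w a) <F rank o (lookup w b)) ≟ᵇ (lookup σ a <F lookup σ b))))
                   (allFin k))
       (allFin k)

-- No occurrence of σ in an inflation of the skeleton o can spread over
-- several blocks. This is a finite property of (o, σ), decided by evaluation.
spreadImpossible : ∀ {k} → Bool → Vec (Fin k) k → Bool
spreadImpossible {k} o σ =
  allB (λ w → not (visitsInOrder w ∧ pointsOnce w ∧ not (oneBlock w)) ∨ skeletonRefutes o σ w) (words k 5)

-- v as an element of Fin n when v < n; the fallback d is never used for the
-- words built below, it only makes the construction total.
clamp : ∀ {n} → ℕ → Fin n → Fin n
clamp {n} v d with v <? n
... | yes v<n = fromℕ< v<n
... | no  _   = d

clamp-value : ∀ {n} v (d : Fin n) → v < n → toℕ (clamp v d) ≡ v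
clamp-value {n} v d v<n with v <? n
... | yes v<n′ = toℕ-fromℕ< v<n′
... | no  v≮n  = ⊥-elim (v≮n v<n)

-- The inflation of the skeleton o by α, β, γ: position p lies in block
-- 'region p' at offset p ∸ start (region p), and its value is the value of
-- that offset in the block, shifted by the block's base value.
module Inflation (n A B C : ℕ) (o : Bool)
                 (α : Vec (Fin A) A) (β : Vec (Fin B) B) (γ : Vec (Fin C) C) where

  size : Fin 5 → ℕ
  size r = positionSize A B C (toℕ r)

  block : (r : Fin 5) → Vec (Fin (size r)) (size r)
  block blockα = α
  block point₁ = fz ∷ []
  block blockβ = β
  block point₂ = fz ∷ []
  block blockγ = γ

  start : Fin 5 → ℕ
  start r = prefixSum (positionSize A B C) (toℕ r)

  base : Fin 5 → ℕ
  base r = prefixSum (valueSize A B C) (toℕ (rank o r))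

  -- 'region' and 'inflation' are opaque: they are only used through
  -- 'region-spec' and 'lookup-inflation'.
  opaque
    region : ℕ → Fin 5
    region p = if p <ᵇ start point₁ then blockα else
               if p <ᵇ start blockβ then point₁ else
               if p <ᵇ start point₂ then blockβ else
               if p <ᵇ start blockγ then point₂ else blockγ

  entry : ℕ → ℕ
  entry p = base (region p) + nth (block (region p)) (p ∸ start (region p))

  opaque
    inflation : Vec (Fin n) n
    inflation = tabulate (λ k → clamp (entry (toℕ k)) k)

  module Valid (total : A + 1 + B + 1 + C ≡ n) where

    total-values : prefixSum (valueSize A B C) 5 ≡ n
    total-values = trans (reorder A B C) total
      where
      reorder : ∀ A B C → A + B + C + 1 + 1 ≡ A + 1 + B + 1 + C
      reorder = solve-∀

    InBlock : ℕ → Fin 5 → Set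
    InBlock p r = start r ≤ p × p < start r + size r

    opaque
      unfolding region
      region-spec : ∀ {p} → p < n → InBlock p (region p)
      region-spec {p} p<n with p <ᵇ start point₁ in h₁
      ... | true  = z≤n , <ᵇ-sound h₁
      ... | false with p <ᵇ start blockβ in h₂
      ...   | true  = <ᵇ-false-sound h₁ , <ᵇ-sound h₂
      ...   | false with p <ᵇ start point₂ in h₃
      ...     | true  = <ᵇ-false-sound h₂ , <ᵇ-sound h₃
      ...     | false with p <ᵇ start blockγ in h₄
      ...       | true  = <ᵇ-false-sound h₃ , <ᵇ-sound h₄
      ...       | false = <ᵇ-false-sound h₄ , subst (p <_) (sym total) p<n

    blocks-ordered : ∀ {r r′} → toℕ r < toℕ r′ → start r + size r ≤ start r′
    blocks-ordered = prefixSum-disjoint (positionSize A B C)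

    InBlock-unique : ∀ {p r r′} → InBlock p r → InBlock p r′ → r ≡ r′
    InBlock-unique {r = r} {r′} (r≤p , p<r) (r′≤p , p<r′) with <-cmp (toℕ r) (toℕ r′)
    ... | tri< r<r′ _ _ = ⊥-elim (<⇒≱ p<r (≤-trans (blocks-ordered r<r′) r′≤p))
    ... | tri≈ _ r≡r′ _ = toℕ-injective r≡r′
    ... | tri> _ _ r′<r = ⊥-elim (<⇒≱ p<r′ (≤-trans (blocks-ordered r′<r) r≤p))

    in-region : ∀ {p r} → p < n → InBlock p r → region p ≡ r
    in-region p<n p∈r = InBlock-unique (region-spec p<n) p∈r

    start+<n : ∀ r {l} → l < size r → start r + l < n
    start+<n r l<size = subst (_ <_) total
      (<-≤-trans (+-monoʳ-< (start r) l<size) (prefixSum-disjoint (positionSize A B C) (toℕ<n r)))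

    region-at : ∀ r {l} → l < size r → region (start r + l) ≡ r
    region-at r l<size = in-region (start+<n r l<size) (m≤m+n (start r) _ , +-monoʳ-< (start r) l<size)

    region-mono : ∀ {p p′} → p ≤ p′ → p′ < n → toℕ (region p) ≤ toℕ (region p′)
    region-mono {p} {p′} p≤p′ p′<n with region-spec (≤-<-trans p≤p′ p′<n) | region-spec p′<n
    ... | p-start , _ | _ , p′-end = ≮⇒≥ later-block
      where
      later-block : toℕ (region p′) < toℕ (region p) → ⊥
      later-block r′<r = <⇒≱ p′-end (≤-trans (blocks-ordered r′<r) (≤-trans p-start p≤p′))

    in-point : ∀ {p r} → isPoint r ≡ true → InBlock p r → p ≡ start r
    in-point {p} {r} point (r≤p , p<end) = ≤-antisym (s≤s⁻¹ p<r+1) r≤p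
      where
      p<r+1 : p < suc (start r)
      p<r+1 = subst (p <_) (trans (cong (start r +_) (point-size r point)) (+-comm (start r) 1)) p<end

    offset<size : ∀ {p} → p < n → p ∸ start (region p) < size (region p)
    offset<size p<n = offset-< (proj₁ (region-spec p<n)) (proj₂ (region-spec p<n))

    -- Each block occupies the values [base r, base r + size r), in skeleton order.
    entry-< : ∀ {p} → p < n → entry p < base (region p) + size (region p)
    entry-< {p} p<n = +-monoʳ-< (base (region p)) (nth-< (block (region p)) (offset<size p<n))

    bases-ordered : ∀ {r r′} → toℕ (rank o r) < toℕ (rank o r′) → base r + size r ≤ base r′
    bases-ordered {r} r<r′ =
      subst (λ len → base r + len ≤ _) (valueSize-rank o r) (prefixSum-disjoint (valueSize A B C) r<r′)

    entry<n : ∀ {p} → p < n → entry p < n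
    entry<n {p} p<n = <-≤-trans (entry-< p<n) (subst (base r + size r ≤_) total-values
      (subst (λ len → base r + len ≤ _) (valueSize-rank o r)
        (prefixSum-disjoint (valueSize A B C) (toℕ<n (rank o r)))))
      where r = region p

    entry-across : ∀ {p p′} → p < n → p′ < n →
                   toℕ (rank o (region p)) < toℕ (rank o (region p′)) → entry p < entry p′
    entry-across {p} {p′} p<n p′<n r<r′ =
      <-≤-trans (entry-< p<n) (≤-trans (bases-ordered {region p} {region p′} r<r′) (m≤m+n _ _))

    entry-<ᵇ-across : ∀ {p p′} → p < n → p′ < n → region p ≢ region p′ →
      (entry p <ᵇ entry p′) ≡ (toℕ (rank o (region p)) <ᵇ toℕ (rank o (region p′)))
    entry-<ᵇ-across p<n p′<n r≢r′ with <-cmp (toℕ (rank o (region _))) (toℕ (rank o (region _)))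
    ... | tri< r<r′ _ _ = trans (<ᵇ-complete (entry-across p<n p′<n r<r′)) (sym (<ᵇ-complete r<r′))
    ... | tri≈ _ r≡r′ _ = ⊥-elim (r≢r′ (rank-injective o (toℕ-injective r≡r′)))
    ... | tri> _ _ r′<r = trans (<ᵇ-false-complete (<⇒≤ (entry-across p′<n p<n r′<r)))
                                (sym (<ᵇ-false-complete (<⇒≤ r′<r)))

    entry-in : ∀ {p r} → region p ≡ r → entry p ≡ base r + nth (block r) (p ∸ start r)
    entry-in refl = refl

    entry-<ᵇ-within : ∀ {p p′ r} → region p ≡ r → region p′ ≡ r →
      (entry p <ᵇ entry p′) ≡ (nth (block r) (p ∸ start r) <ᵇ nth (block r) (p′ ∸ start r))
    entry-<ᵇ-within {r = r} in-r in-r′ rewrite entry-in in-r | entry-in in-r′ = shift (base r) _ _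
      where
      shift : ∀ a x y → (a + x <ᵇ a + y) ≡ (x <ᵇ y)
      shift zero    x y = refl
      shift (suc a) x y = shift a x y

    opaque
      unfolding inflation
      lookup-inflation : ∀ k → toℕ (lookup inflation k) ≡ entry (toℕ k)
      lookup-inflation k = trans (cong toℕ (lookup∘tabulate _ k)) (clamp-value _ k (entry<n (toℕ<n k)))

    nth-inflation : ∀ {p} → p < n → nth inflation p ≡ entry p
    nth-inflation {p} p<n = begin
      nth inflation p                       ≡⟨ cong (nth inflation) (toℕ-fromℕ< p<n) ⟨
      nth inflation (toℕ (fromℕ< p<n))      ≡⟨ nth-lookup inflation (fromℕ< p<n) ⟩
      toℕ (lookup inflation (fromℕ< p<n))   ≡⟨ lookup-inflation (fromℕ< p<n) ⟩
      entry (toℕ (fromℕ< p<n))              ≡⟨ cong entry (toℕ-fromℕ< p<n) ⟩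
      entry p                               ∎
      where open ≡-Reasoning

    nth-inflation-block : ∀ r {l} → l < size r → nth inflation (start r + l) ≡ base r + nth (block r) l
    nth-inflation-block r {l} l<size = begin
      nth inflation (start r + l)   ≡⟨ nth-inflation (start+<n r l<size) ⟩
      entry (start r + l)           ≡⟨ entry-in (region-at r l<size) ⟩
      base r + nth (block r) (start r + l ∸ start r) ≡⟨ cong (λ i → base r + nth (block r) i) (m+n∸m≡n (start r) l) ⟩
      base r + nth (block r) l      ∎
      where open ≡-Reasoning

    entry-≢-across : ∀ {p p′} → p < n → p′ < n → region p ≢ region p′ → entry p ≢ entry p′
    entry-≢-across {p} {p′} p<n p′<n r≢r′ same with <-cmp (toℕ (rank o (region p))) (toℕ (rank o (region p′)))
    ... | tri< r<r′ _ _ = <⇒≢ (entry-across p<n p′<n r<r′) same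
    ... | tri≈ _ r≡r′ _ = r≢r′ (rank-injective o (toℕ-injective r≡r′))
    ... | tri> _ _ r′<r = <⇒≢ (entry-across p′<n p<n r′<r) (sym same)

    entry-injective-within : ∀ {r} → isInjective (block r) ≡ true →
      ∀ {p p′} → InBlock p r → InBlock p′ r → region p ≡ r → region p′ ≡ r → entry p ≡ entry p′ → p ≡ p′
    entry-injective-within {r} inj {p} {p′} p∈r p′∈r in-r in-r′ same = begin
      p                      ≡⟨ m∸n+n≡m (proj₁ p∈r) ⟨
      p ∸ start r + start r  ≡⟨ cong (_+ start r) same-offset ⟩
      p′ ∸ start r + start r ≡⟨ m∸n+n≡m (proj₁ p′∈r) ⟩
      p′                     ∎
      where
      open ≡-Reasoning
      same-offset : p ∸ start r ≡ p′ ∸ start r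
      same-offset = nth-injective {v = block r} inj (offset-< (proj₁ p∈r) (proj₂ p∈r)) (offset-< (proj₁ p′∈r) (proj₂ p′∈r))
        (+-cancelˡ-≡ (base r) _ _ (trans (sym (entry-in in-r)) (trans same (entry-in in-r′))))

    entry-injective : (∀ r → isInjective (block r) ≡ true) →
                      ∀ {p p′} → p < n → p′ < n → entry p ≡ entry p′ → p ≡ p′
    entry-injective inj {p} {p′} p<n p′<n same with region p ≟F region p′
    ... | no  r≢r′ = ⊥-elim (entry-≢-across p<n p′<n r≢r′ same)
    ... | yes r≡r′ = entry-injective-within (inj (region p)) (region-spec p<n)
                       (subst (InBlock p′) (sym r≡r′) (region-spec p′<n)) refl (sym r≡r′) same

    inflation-injective : (∀ r → isInjective (block r) ≡ true) → isInjective inflation ≡ true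
    inflation-injective inj = isInjective-complete {w = inflation} λ k k′ same →
      toℕ-injective (entry-injective inj (toℕ<n k) (toℕ<n k′)
        (trans (sym (lookup-inflation k)) (trans (cong toℕ same) (lookup-inflation k′))))

    module OccurrenceAt {k} (σ : Vec (Fin (suc k)) (suc k)) (idx : Vec (Fin n) (suc k))
                        (idx-increasing : increasing idx ≡ true) (idx-pattern : orderIso inflation σ idx ≡ true) where

      pos : Fin (suc k) → ℕ
      pos a = toℕ (lookup idx a)

      pos<n : ∀ a → pos a < n
      pos<n a = toℕ<n (lookup idx a)

      pos-increasing : ∀ {a b} → (toℕ a <ᵇ toℕ b) ≡ true → pos a < pos b
      pos-increasing {a} {b} a<b = increasing-sound {idx = idx} idx-increasing a b (<ᵇ-sound a<b)

      visited : Vec (Fin 5) (suc k)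
      visited = tabulate (λ a → region (pos a))

      visited-region : ∀ a → lookup visited a ≡ region (pos a)
      visited-region = lookup∘tabulate _

      entries-like-σ : ∀ a b → (entry (pos a) <ᵇ entry (pos b)) ≡ (lookup σ a <F lookup σ b)
      entries-like-σ a b = trans (sym (cong₂ _<ᵇ_ (lookup-inflation (lookup idx a)) (lookup-inflation (lookup idx b))))
                                 (orderIso-sound {π = inflation} {σ} {idx} idx-pattern a b)

      visits-in-order : visitsInOrder visited ≡ true
      visits-in-order = All²-complete in-order
        where
        in-order : ∀ a b → (not (a <F b) ∨ not (lookup visited b <F lookup visited a)) ≡ true
        in-order a b with toℕ a <ᵇ toℕ b in a<b
        ... | false = refl
        ... | true rewrite visited-region a | visited-region b =
          cong not (<ᵇ-false-complete (region-mono (<⇒≤ (pos-increasing a<b)) (pos<n b)))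

      points-once : pointsOnce visited ≡ true
      points-once = All²-complete once
        where
        once : ∀ a b → (not (a <F b) ∨ not (isPoint (lookup visited a) ∧ does (lookup visited a ≟F lookup visited b))) ≡ true
        once a b with toℕ a <ᵇ toℕ b in a<b
        ... | false = refl
        ... | true with isPoint (lookup visited a) in point | lookup visited a ≟F lookup visited b
        ...   | false | _        = refl
        ...   | true  | no _     = refl
        ...   | true  | yes same = ⊥-elim (<⇒≢ (pos-increasing a<b) (trans (in-point r-point a∈r) (sym (in-point r-point b∈r))))
          where
          r = region (pos a)
          r-point : isPoint r ≡ true
          r-point = trans (cong isPoint (sym (visited-region a))) point
          a∈r : InBlock (pos a) r
          a∈r = region-spec (pos<n a)
          b∈r : InBlock (pos b) r
          b∈r = subst (InBlock (pos b)) (trans (sym (visited-region b)) (trans (sym same) (visited-region a)))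
                      (region-spec (pos<n b))

      within-block : oneBlock visited ≡ true → Occurrence (block (region (pos fz))) σ
      within-block one = idx′ , increasing-complete {idx = idx′} idx′-increasing , orderIso-complete {π = block r} {σ} {idx′} idx′-pattern
        where
        r = region (pos fz)
        in-r : ∀ a → region (pos a) ≡ r
        in-r a = trans (sym (visited-region a)) (trans (does-sound (_ ≟F _) (All²-sound one a fz)) (visited-region fz))
        a∈r : ∀ a → InBlock (pos a) r
        a∈r a = subst (InBlock (pos a)) (in-r a) (region-spec (pos<n a))
        offset : Fin (suc k) → ℕ
        offset a = pos a ∸ start r
        offset-fits : ∀ a → offset a < size r
        offset-fits a = offset-< (proj₁ (a∈r a)) (proj₂ (a∈r a))
        idx′ : Vec (Fin (size r)) (suc k)
        idx′ = tabulate (λ a → fromℕ< (offset-fits a))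
        idx′-offset : ∀ a → toℕ (lookup idx′ a) ≡ offset a
        idx′-offset a = trans (cong toℕ (lookup∘tabulate (λ a → fromℕ< (offset-fits a)) a)) (toℕ-fromℕ< (offset-fits a))
        idx′-increasing : ∀ a b → toℕ a < toℕ b → toℕ (lookup idx′ a) < toℕ (lookup idx′ b)
        idx′-increasing a b a<b = subst₂ _<_ (sym (idx′-offset a)) (sym (idx′-offset b))
          (∸-monoˡ-< (increasing-sound {idx = idx} idx-increasing a b a<b) (proj₁ (a∈r a)))
        value : ∀ a → toℕ (lookup (block r) (lookup idx′ a)) ≡ nth (block r) (offset a)
        value a = trans (sym (nth-lookup (block r) (lookup idx′ a))) (cong (nth (block r)) (idx′-offset a))
        idx′-pattern : ∀ a b → (lookup (block r) (lookup idx′ a) <F lookup (block r) (lookup idx′ b)) ≡ (lookup σ a <F lookup σ b)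
        idx′-pattern a b = trans (cong₂ _<ᵇ_ (value a) (value b))
          (trans (sym (entry-<ᵇ-within (in-r a) (in-r b))) (entries-like-σ a b))

      -- Two points in different blocks compare as in the skeleton, so the skeleton cannot refute σ.
      across-blocks : skeletonRefutes o σ visited ≡ true → ⊥
      across-blocks refutes with Any²-sound {k = suc k} refutes
      ... | a , b , witness with ∧-true witness
      ...   | different , disagree = does-refute (_ ≟ᵇ _) disagree (begin
        toℕ (rank o (lookup visited a)) <ᵇ toℕ (rank o (lookup visited b))
          ≡⟨ cong₂ (λ x y → toℕ (rank o x) <ᵇ toℕ (rank o y)) (visited-region a) (visited-region b) ⟩
        toℕ (rank o (region (pos a))) <ᵇ toℕ (rank o (region (pos b)))
          ≡⟨ entry-<ᵇ-across (pos<n a) (pos<n b) regions-differ ⟨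
        entry (pos a) <ᵇ entry (pos b)
          ≡⟨ entries-like-σ a b ⟩
        lookup σ a <F lookup σ b ∎)
        where
        open ≡-Reasoning
        regions-differ : region (pos a) ≢ region (pos b)
        regions-differ e = does-refute (_ ≟F _) different (trans (visited-region a) (trans e (sym (visited-region b))))

      no-occurrence : spreadImpossible o σ ≡ true → (∀ r → contains (block r) σ ≡ false) → ⊥
      no-occurrence spread blocks-avoid with oneBlock visited in one
      ... | true  = false≢true (trans (sym (blocks-avoid (region (pos fz)))) (contains-complete {π = block (region (pos fz))} {σ} (within-block one)))
      ... | false = across-blocks (modus-ponens visits-in-order points-once one
                                    (allB-sound {xs = words (suc k) 5} spread (∈-words visited)))
        where
        modus-ponens : ∀ {x y z r : Bool} → x ≡ true → y ≡ true → z ≡ false → (not (x ∧ y ∧ not z) ∨ r) ≡ true → r ≡ true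
        modus-ponens refl refl refl r = r

    inflation-avoids : ∀ {k} (σ : Vec (Fin (suc k)) (suc k)) → spreadImpossible o σ ≡ true →
                       (∀ r → contains (block r) σ ≡ false) → contains inflation σ ≡ false
    inflation-avoids σ spread blocks-avoid with contains inflation σ in found
    ... | false = refl
    ... | true with contains-sound {π = inflation} {σ} found
    ...   | idx , inc , iso = ⊥-elim (OccurrenceAt.no-occurrence σ idx inc iso spread blocks-avoid)

    point-nonempty : ∀ r → isPoint r ≡ true → 0 < size r
    point-nonempty r point = subst (0 <_) (sym (point-size r point)) (s≤s z≤n)

    point-position<n : ∀ r → isPoint r ≡ true → start r < n
    point-position<n r point = subst (_< n) (+-identityʳ (start r)) (start+<n r (point-nonempty r point))

    point-value : ∀ r → isPoint r ≡ true → nth inflation (start r) ≡ base r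
    point-value r point = begin
      nth inflation (start r)        ≡⟨ cong (nth inflation) (+-identityʳ (start r)) ⟨
      nth inflation (start r + 0)    ≡⟨ nth-inflation-block r (point-nonempty r point) ⟩
      base r + nth (block r) 0       ≡⟨ cong (base r +_) (point-block-value r point) ⟩
      base r + 0                     ≡⟨ +-identityʳ (base r) ⟩
      base r                         ∎
      where
      open ≡-Reasoning
      point-block-value : ∀ r → isPoint r ≡ true → nth (block r) 0 ≡ 0
      point-block-value point₁ _ = refl
      point-block-value point₂ _ = refl

    top-value : nth inflation (start (topPoint o)) + 1 ≡ n
    top-value = begin
      nth inflation (start (topPoint o)) + 1   ≡⟨ cong (_+ 1) (point-value (topPoint o) (isPoint-topPoint o)) ⟩
      base (topPoint o) + 1                    ≡⟨ cong (λ i → prefixSum (valueSize A B C) (toℕ i) + 1) (rank-topPoint o) ⟩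
      prefixSum (valueSize A B C) 5            ≡⟨ total-values ⟩
      n                                        ∎
      where open ≡-Reasoning

    second-value : nth inflation (start (secondPoint o)) + 2 ≡ n
    second-value = begin
      nth inflation (start (secondPoint o)) + 2 ≡⟨ cong (_+ 2) (point-value (secondPoint o) (isPoint-secondPoint o)) ⟩
      base (secondPoint o) + 2                  ≡⟨ cong (λ i → prefixSum (valueSize A B C) (toℕ i) + 2) (rank-secondPoint o) ⟩
      prefixSum (valueSize A B C) 3 + 2         ≡⟨ +-assoc (prefixSum (valueSize A B C) 3) 1 1 ⟨
      prefixSum (valueSize A B C) 5             ≡⟨ total-values ⟩
      n                                         ∎
      where open ≡-Reasoning

open Inflation using (inflation)

inflation-blocks-injective : ∀ {n A B C} o {α α′ β β′ γ γ′} → A + 1 + B + 1 + C ≡ n →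
  inflation n A B C o α β γ ≡ inflation n A B C o α′ β′ γ′ → α ≡ α′ × β ≡ β′ × γ ≡ γ′
inflation-blocks-injective {n} {A} {B} {C} o {α} {α′} {β} {β′} {γ} {γ′} total same =
  nth-ext α α′ (agree blockα) , nth-ext β β′ (agree blockβ) , nth-ext γ γ′ (agree blockγ)
  where
  module I  = Inflation n A B C o α  β  γ
  module I′ = Inflation n A B C o α′ β′ γ′
  agree : ∀ r l → l < I.size r → nth (I.block r) l ≡ nth (I′.block r) l
  agree r l l<size = +-cancelˡ-≡ (I.base r) _ _ (begin
    I.base r + nth (I.block r) l     ≡⟨ I.Valid.nth-inflation-block total r l<size ⟨
    nth I.inflation (I.start r + l)  ≡⟨ cong (λ π → nth π (I.start r + l)) same ⟩
    nth I′.inflation (I.start r + l) ≡⟨ I′.Valid.nth-inflation-block total r l<size ⟩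
    I.base r + nth (I′.block r) l    ∎)
    where open ≡-Reasoning

-- … and, being a permutation, its shape: the positions A and A + 1 + B of its
-- two point blocks, in an order that tells the skeleton.
+1+-cancelˡ : ∀ {A A′ B B′} → A ≡ A′ → A + 1 + B ≡ A′ + 1 + B′ → B ≡ B′
+1+-cancelˡ {A} refl e = +-cancelˡ-≡ (A + 1) _ _ e

points-uncrossed : ∀ {A A′ B B′} → A ≡ A′ + 1 + B′ → A + 1 + B ≡ A′ → ⊥
points-uncrossed {A} {A′} {B} {B′} e₁ e₂ = <-irrefl refl (begin-strict
  A            <⟨ beyond A B ⟩
  A + 1 + B    ≡⟨ e₂ ⟩
  A′           <⟨ beyond A′ B′ ⟩
  A′ + 1 + B′  ≡⟨ e₁ ⟨
  A            ∎)
  where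
  open ≤-Reasoning
  beyond : ∀ x y → x < x + 1 + y
  beyond x y = <-≤-trans (m<m+n x (s≤s z≤n)) (m≤m+n (x + 1) y)

-- The positions of the two largest values determine A, B and the skeleton.
shape-from-points : ∀ o o′ {A B C A′ B′ C′} →
  prefixSum (positionSize A B C) (toℕ (topPoint o)) ≡ prefixSum (positionSize A′ B′ C′) (toℕ (topPoint o′)) →
  prefixSum (positionSize A B C) (toℕ (secondPoint o)) ≡ prefixSum (positionSize A′ B′ C′) (toℕ (secondPoint o′)) →
  A ≡ A′ × B ≡ B′ × o ≡ o′
shape-from-points false false A≡A′ e = A≡A′ , +1+-cancelˡ A≡A′ e , refl
shape-from-points true  true  e A≡A′ = A≡A′ , +1+-cancelˡ A≡A′ e , refl
shape-from-points false true  e₁ e₂ = ⊥-elim (points-uncrossed e₁ e₂)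
shape-from-points true  false e₁ e₂ = ⊥-elim (points-uncrossed e₂ e₁)

inflation-shape-injective : ∀ {n A B C A′ B′ C′} o o′ {α β γ α′ β′ γ′} →
  A + 1 + B + 1 + C ≡ n → A′ + 1 + B′ + 1 + C′ ≡ n → isInjective (inflation n A B C o α β γ) ≡ true →
  inflation n A B C o α β γ ≡ inflation n A′ B′ C′ o′ α′ β′ γ′ → A ≡ A′ × B ≡ B′ × o ≡ o′
inflation-shape-injective {n} {A} {B} {C} {A′} {B′} {C′} o o′ {α} {β} {γ} {α′} {β′} {γ′} total total′ inj same =
  shape-from-points o o′
    (same-position 1 (I.point-position<n _ (isPoint-topPoint o)) (I′.point-position<n _ (isPoint-topPoint o′))
                     I.top-value I′.top-value)
    (same-position 2 (I.point-position<n _ (isPoint-secondPoint o)) (I′.point-position<n _ (isPoint-secondPoint o′))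
                     I.second-value I′.second-value)
  where
  module I  = Inflation.Valid n A  B  C  o  α  β  γ  total
  module I′ = Inflation.Valid n A′ B′ C′ o′ α′ β′ γ′ total′
  π  = inflation n A  B  C  o  α  β  γ
  π′ = inflation n A′ B′ C′ o′ α′ β′ γ′
  same-position : ∀ c {p p′} → p < n → p′ < n → nth π p + c ≡ n → nth π′ p′ + c ≡ n → p ≡ p′
  same-position c {p} {p′} p<n p′<n at-p at-p′ = nth-injective {v = π} inj p<n p′<n
    (+-cancelʳ-≡ c _ _ (trans at-p (trans (sym at-p′) (cong (λ w → nth w p′ + c) (sym same)))))

spread-impossible : ∀ o → ForEachPattern (λ σ → spreadImpossible o σ ≡ true)
spread-impossible false = refl , refl , refl , refl
spread-impossible true  = refl , refl , refl , refl

inflation-avoider : ∀ {n A B C} o {α β γ} → A + 1 + B + 1 + C ≡ n →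
  Avoider α → Avoider β → Avoider γ → Avoider (inflation n A B C o α β γ)
inflation-avoider {n} {A} {B} {C} o {α} {β} {γ} total α-avoids β-avoids γ-avoids =
  V.inflation-injective (λ r → proj₁ (blocks r)) ,
  avoidsAll-complete {π = I.inflation}
    (zipPatterns V.inflation-avoids (spread-impossible o)
                 (patterns-∀ {P = λ r σ → contains (I.block r) σ ≡ false}
                             (λ r → avoidsAll-sound {π = I.block r} (proj₂ (blocks r)))))
  where
  module I = Inflation n A B C o α β γ
  module V = I.Valid total
  blocks : ∀ r → Avoider (I.block r)
  blocks blockα = α-avoids
  blocks point₁ = refl , refl
  blocks blockβ = β-avoids
  blocks point₂ = refl , refl
  blocks blockγ = γ-avoids

lastSize : ℕ → ℕ → ℕ → ℕ
lastSize n A B = n ∸ suc (suc (A + B))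

Triple : ℕ → ℕ → ℕ → Set
Triple A B C = Vec (Fin A) A × Vec (Fin B) B × Vec (Fin C) C

avoiderTriples : ∀ A B C → List (Triple A B C)
avoiderTriples A B C = cartesianProduct (avoiders A) (cartesianProduct (avoiders B) (avoiders C))

unique-avoiderTriples : ∀ A B C → Unique (avoiderTriples A B C)
unique-avoiderTriples A B C =
  Unique.cartesianProduct⁺ (unique-avoiders A) (Unique.cartesianProduct⁺ (unique-avoiders B) (unique-avoiders C))

length-avoiderTriples : ∀ A B C → length (avoiderTriples A B C) ≡ q A * (q B * q C)
length-avoiderTriples A B C = begin
  length (avoiderTriples A B C)
    ≡⟨ length-cartesianProduct (avoiders A) _ ⟩
  length (avoiders A) * length (cartesianProduct (avoiders B) (avoiders C))
    ≡⟨ cong (length (avoiders A) *_) (length-cartesianProduct (avoiders B) (avoiders C)) ⟩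
  length (avoiders A) * (length (avoiders B) * length (avoiders C))
    ≡⟨ cong₂ (λ x y → x * y) (q≡length-avoiders A) (cong₂ _*_ (q≡length-avoiders B) (q≡length-avoiders C)) ⟨
  q A * (q B * q C) ∎
  where open ≡-Reasoning

inflate : ∀ n A B C → Bool → Triple A B C → Vec (Fin n) n
inflate n A B C o (α , β , γ) = inflation n A B C o α β γ

inflations : (n A B : ℕ) → Bool → List (Vec (Fin n) n)
inflations n A B o = map (inflate n A B (lastSize n A B) o) (avoiderTriples A B (lastSize n A B))

inflationsOfShape : (n A B : ℕ) → List (Vec (Fin n) n)
inflationsOfShape n A B = inflations n A B false ++ inflations n A B true

inflationsWithFirst : (n A : ℕ) → List (Vec (Fin n) n)
inflationsWithFirst n A = concatMap (inflationsOfShape n A) (upTo (n ∸ suc A))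

family : (n : ℕ) → List (Vec (Fin n) n)
family n = concatMap (inflationsWithFirst n) (upTo (n ∸ 1))

Shape : ℕ → ℕ → ℕ → Set
Shape n A B = A < n ∸ 1 × B < n ∸ suc A

shape-total : ∀ {n A B} → Shape n A B → A + 1 + B + 1 + lastSize n A B ≡ n
shape-total {n} {A} {B} (A<n-1 , B<n-A-1) = trans (reassociate A B (lastSize n A B)) (m+[n∸m]≡n two+A+B≤n)
  where
  reassociate : ∀ A B C → A + 1 + B + 1 + C ≡ suc (suc (A + B)) + C
  reassociate = solve-∀
  swap : ∀ A B → suc B + suc A ≡ suc (suc (A + B))
  swap = solve-∀
  two+A+B≤n : suc (suc (A + B)) ≤ n
  two+A+B≤n = subst (_≤ n) (swap A B) (m≤o∸n⇒m+n≤o (suc B) (≤-trans A<n-1 (m∸n≤m n 1)) B<n-A-1)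

record Inflated (n A B : ℕ) (o : Bool) (π : Vec (Fin n) n) : Set where
  field
    α : Vec (Fin A) A
    β : Vec (Fin B) B
    γ : Vec (Fin (lastSize n A B)) (lastSize n A B)
    α∈ : α ∈ avoiders A
    β∈ : β ∈ avoiders B
    γ∈ : γ ∈ avoiders (lastSize n A B)
    π≡ : π ≡ inflation n A B (lastSize n A B) o α β γ

∈-inflations : ∀ {n A B o π} → π ∈ inflations n A B o → Inflated n A B o π
∈-inflations {n} {A} {B} {o} π∈ with ∈-map⁻ (inflate n A B (lastSize n A B) o) π∈
... | (α , β , γ) , αβγ∈ , refl with ∈-cartesianProduct⁻ (avoiders A) (cartesianProduct (avoiders B) (avoiders (lastSize n A B))) αβγ∈
...   | α∈ , βγ∈ with ∈-cartesianProduct⁻ (avoiders B) (avoiders (lastSize n A B)) βγ∈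
...     | β∈ , γ∈ = record { α = α ; β = β ; γ = γ ; α∈ = α∈ ; β∈ = β∈ ; γ∈ = γ∈ ; π≡ = refl }

∈-inflationsOfShape : ∀ {n A B π} → π ∈ inflationsOfShape n A B → ∃ λ o → Inflated n A B o π
∈-inflationsOfShape {n} {A} {B} π∈ with ∈-++⁻ (inflations n A B false) π∈
... | inj₁ π∈false = false , ∈-inflations π∈false
... | inj₂ π∈true  = true  , ∈-inflations π∈true

∈-inflationsWithFirst : ∀ {n A π} → π ∈ inflationsWithFirst n A → ∃ λ B → B ∈ upTo (n ∸ suc A) × π ∈ inflationsOfShape n A B
∈-inflationsWithFirst {n} {A} π∈ with ∈-concat⁻′ (map (inflationsOfShape n A) (upTo (n ∸ suc A))) π∈
... | _ , π∈πs , πs∈ with ∈-map⁻ (inflationsOfShape n A) πs∈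
...   | B , B∈ , refl = B , B∈ , π∈πs

∈-family : ∀ {n π} → π ∈ family n → ∃ λ A → ∃ λ B → Shape n A B × ∃ λ o → Inflated n A B o π
∈-family {n} π∈ with ∈-concat⁻′ (map (inflationsWithFirst n) (upTo (n ∸ 1))) π∈
... | _ , π∈πs , πs∈ with ∈-map⁻ (inflationsWithFirst n) πs∈
...   | A , A∈ , refl with ∈-inflationsWithFirst π∈πs
...     | B , B∈ , π∈shape = A , B , (∈-upTo⁻ A∈ , ∈-upTo⁻ B∈) , ∈-inflationsOfShape π∈shape

inflated-avoider : ∀ {n A B o π} → Shape n A B → Inflated n A B o π → Avoider π
inflated-avoider {n} {A} {B} {o} shape inf = subst Avoider (sym π≡)
  (inflation-avoider {n} {A} {B} {lastSize n A B} o {α} {β} {γ} (shape-total shape) (avoiders-sound α∈) (avoiders-sound β∈) (avoiders-sound γ∈))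
  where open Inflated inf

inflated-shape : ∀ {n A B o A′ B′ o′ π} → Shape n A B → Shape n A′ B′ →
                 Inflated n A B o π → Inflated n A′ B′ o′ π → A ≡ A′ × B ≡ B′ × o ≡ o′
inflated-shape {o = o} {o′ = o′} shape shape′ inf inf′ =
  inflation-shape-injective o o′ (shape-total shape) (shape-total shape′)
    (subst (λ π → isInjective π ≡ true) (Inflated.π≡ inf) (proj₁ (inflated-avoider shape inf)))
    (trans (sym (Inflated.π≡ inf)) (Inflated.π≡ inf′))

family-avoiders : ∀ {n π} → π ∈ family n → Avoider π
family-avoiders π∈ with ∈-family π∈
... | _ , _ , shape , _ , inf = inflated-avoider shape inf

-- Distinct triples of blocks give distinct inflations, and distinct shapes
-- give disjoint lists, so the family has no repetitions.
unique-inflationsOfShape : ∀ {n A B} → Shape n A B → Unique (inflationsOfShape n A B)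
unique-inflationsOfShape {n} {A} {B} shape = Unique.++⁺ (unique-skeleton false) (unique-skeleton true) skeletons-differ
  where
  C = lastSize n A B
  inflate-injective : ∀ o {t t′} → inflate n A B C o t ≡ inflate n A B C o t′ → t ≡ t′
  inflate-injective o {α , β , γ} {α′ , β′ , γ′} same with inflation-blocks-injective o (shape-total shape) same
  ... | refl , refl , refl = refl
  unique-skeleton : ∀ o → Unique (inflations n A B o)
  unique-skeleton o = Unique.map⁺ (inflate-injective o) (unique-avoiderTriples A B C)
  skeletons-differ : ∀ {π} → ¬ (π ∈ inflations n A B false × π ∈ inflations n A B true)
  skeletons-differ (π∈false , π∈true) = false≢true (proj₂ (proj₂ (inflated-shape shape shape (∈-inflations π∈false) (∈-inflations π∈true))))

unique-family : ∀ n → Unique (family n)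
unique-family n = unique-concatMap (inflationsWithFirst n) (Unique.upTo⁺ _) unique-with-first same-first
  where
  shape-of : ∀ {A B} → A ∈ upTo (n ∸ 1) → B ∈ upTo (n ∸ suc A) → Shape n A B
  shape-of A∈ B∈ = ∈-upTo⁻ A∈ , ∈-upTo⁻ B∈
  unique-with-first : ∀ {A} → A ∈ upTo (n ∸ 1) → Unique (inflationsWithFirst n A)
  unique-with-first A∈ = unique-concatMap (inflationsOfShape n _) (Unique.upTo⁺ _)
    (λ B∈ → unique-inflationsOfShape (shape-of A∈ B∈))
    (λ B∈ B′∈ π∈ π∈′ → proj₁ (proj₂ (inflated-shape (shape-of A∈ B∈) (shape-of A∈ B′∈)
                                        (proj₂ (∈-inflationsOfShape π∈)) (proj₂ (∈-inflationsOfShape π∈′)))))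
  same-first : ∀ {A A′ π} → A ∈ upTo (n ∸ 1) → A′ ∈ upTo (n ∸ 1) →
               π ∈ inflationsWithFirst n A → π ∈ inflationsWithFirst n A′ → A ≡ A′
  same-first A∈ A′∈ π∈ π∈′ with ∈-inflationsWithFirst π∈ | ∈-inflationsWithFirst π∈′
  ... | _ , B∈ , π∈shape | _ , B′∈ , π∈shape′ =
    proj₁ (inflated-shape (shape-of A∈ B∈) (shape-of A′∈ B′∈)
                          (proj₂ (∈-inflationsOfShape π∈shape)) (proj₂ (∈-inflationsOfShape π∈shape′)))

family≤q : ∀ n → length (family n) ≤ q n
family≤q n = length≤q (unique-family n) family-avoiders

length-inflationsOfShape : ∀ n A B → length (inflationsOfShape n A B) ≡ 2 * q A * q B * q (lastSize n A B)
length-inflationsOfShape n A B = begin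
  length (inflationsOfShape n A B)                   ≡⟨ length-++ (inflations n A B false) ⟩
  length (inflations n A B false) + length (inflations n A B true) ≡⟨ cong₂ _+_ (per-skeleton false) (per-skeleton true) ⟩
  q A * (q B * q C) + q A * (q B * q C)              ≡⟨ double (q A) (q B) (q C) ⟩
  2 * q A * q B * q C                                ∎
  where
  open ≡-Reasoning
  C = lastSize n A B
  double : ∀ a b c → a * (b * c) + a * (b * c) ≡ 2 * a * b * c
  double = solve-∀
  per-skeleton : ∀ o → length (inflations n A B o) ≡ q A * (q B * q C)
  per-skeleton o = trans (length-map (inflate n A B C o) (avoiderTriples A B C)) (length-avoiderTriples A B C)

length-sTable : ∀ m → length (sTable m) ≡ suc m
length-sTable zero          = refl
length-sTable (suc zero)    = refl
length-sTable (suc (suc m)) =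
  trans (length-++ (sTable (suc m))) (trans (cong (_+ 1) (length-sTable (suc m))) (+-comm (suc (suc m)) 1))

at-++ˡ : ∀ xs ys {k} → k < length xs → at (xs ++ ys) k ≡ at xs k
at-++ˡ (x ∷ xs) ys {zero}  _         = refl
at-++ˡ (x ∷ xs) ys {suc k} (s≤s k<) = at-++ˡ xs ys k<

at-last : ∀ xs y → at (xs ++ [ y ]) (length xs) ≡ y
at-last []       y = refl
at-last (x ∷ xs) y = at-last xs y

at-sTable : ∀ m k → k ≤ m → at (sTable m) k ≡ s k
at-sTable zero          zero          _ = refl
at-sTable (suc zero)    zero          _ = refl
at-sTable (suc zero)    (suc zero)    _ = refl
at-sTable (suc zero)    (suc (suc k)) (s≤s ())
at-sTable (suc (suc m)) k k≤m+2 =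
  [ (λ k<m+2 → trans (at-++ˡ (sTable (suc m)) _ (subst (k <_) (sym (length-sTable (suc m))) k<m+2))
                     (at-sTable (suc m) k (s≤s⁻¹ k<m+2)))
  , (λ { refl → refl }) ]′ (m≤n⇒m<n∨m≡n k≤m+2)

s-step : ∀ m → s (suc (suc m)) ≡ sStep (suc (suc m)) (sTable (suc m))
s-step m = subst (λ i → at (sTable (suc m) ++ [ next ]) i ≡ next) (length-sTable (suc m)) (at-last (sTable (suc m)) next)
  where next = sStep (suc (suc m)) (sTable (suc m))

-- The middle index of the recursion is B when i = A + 1 and j = A + B + 2.
middle-index : ∀ A B → (suc (A + B) ∸ A) ∸ 1 ≡ B
middle-index zero    B = refl
middle-index (suc A) B = middle-index A B

sStep≤family : ∀ m → (∀ k → k ≤ suc m → s k ≤ q k) → sStep (suc (suc m)) (sTable (suc m)) ≤ length (family (suc (suc m)))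
sStep≤family m s≤q-below = subst (sStep n t ≤_) (sym (length-concatMap (inflationsWithFirst n) (upTo (n ∸ 1))))
  (sumL-mono (upTo (n ∸ 1)) (λ A∈ → row (∈-upTo⁻ A∈)))
  where
  n = suc (suc m)
  t = sTable (suc m)
  t≤q : ∀ {k} → k ≤ suc m → at t k ≤ q k
  t≤q {k} k≤ = subst (_≤ q k) (sym (at-sTable (suc m) k k≤)) (s≤q-below k k≤)
  summand : ∀ {A} → A < suc m → ∀ {B} → B < n ∸ suc A →
            2 * at t A * at t ((suc (A + B) ∸ A) ∸ 1) * at t (lastSize n A B) ≤ length (inflationsOfShape n A B)
  summand {A} A< {B} B< = flip ≤-trans (≤-reflexive (sym (length-inflationsOfShape n A B)))
    (*-mono-≤ (*-mono-≤ (*-mono-≤ (≤-refl {2}) (t≤q (<⇒≤ A<)))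
                        (subst (λ i → at t i ≤ q B) (sym (middle-index A B)) (t≤q (≤-trans (<⇒≤ B<) (m∸n≤m (suc m) A)))))
              (t≤q (≤-trans (m∸n≤m m (A + B)) (n≤1+n m))))
  row : ∀ {A} → A < suc m → Σ[ suc (suc A) ⋯ n ] (λ j → 2 * at t A * at t (j ∸ suc A ∸ 1) * at t (n ∸ j))
                            ≤ length (inflationsWithFirst n A)
  row {A} A< = flip ≤-trans (≤-reflexive (sym (length-concatMap (inflationsOfShape n A) (upTo (n ∸ suc A)))))
    (sumL-mono (upTo (n ∸ suc A)) (λ B∈ → summand A< (∈-upTo⁻ B∈)))

proposition7 : (n : ℕ) → q n ≥ s n
proposition7 = <-rec (λ n → s n ≤ q n) step
  where
  step : ∀ n → (∀ {k} → k < n → s k ≤ q k) → s n ≤ q n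
  step zero          _         = s≤s z≤n
  step (suc zero)    _         = s≤s z≤n
  step (suc (suc m)) s≤q-below = begin
    s (suc (suc m))                          ≡⟨ s-step m ⟩
    sStep (suc (suc m)) (sTable (suc m))     ≤⟨ sStep≤family m (λ k k≤ → s≤q-below (s≤s k≤)) ⟩
    length (family (suc (suc m)))            ≤⟨ family≤q (suc (suc m)) ⟩
    q (suc (suc m))                          ∎
    where open ≤-Reasoning
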